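{- Let $k_1,k_2,k_3\in\mathbb{Z}_{\geq 0}$ and consider the Diophantine equation \[x^2+y^2+z^2+k_1xy+k_2yz+k_3zx=(3+k_1+k_2+k_3)xyz. \qquad (\ast)\] Every positive integer solution $(x,y,z)$ of $(\ast)$ appears exactly once as a vertex of the tree $\mathbb{T}^{k_1,k_2,k_3}$ (defined in the context).
   Context: The tree $\mathbb{T}^{k_1,k_2,k_3}$ has triplets of positive integers as vertices and is built as follows. (1) The root vertex is $(1,1,1)$. (2) The root $(1,1,1)$ has exactly three children: $(k_2+2,1,1)$, $(1,k_3+2,1)$, $(1,1,k_1+2)$. (3) Every vertex $(a,b,c)$ other than the root has exactly two children, determined as follows: (i) if $a$ is the maximal number in $(a,b,c)$, the children are $\left(a,\frac{a^2+k_3ac+c^2}{b},c\right)$ and $\left(a,b,\frac{a^2+k_1ab+b^2}{c}\right)$; (ii) if $b$ is the maximal number in $(a,b,c)$, the children are $\left(\frac{b^2+k_2bc+c^2}{a},b,c\right)$ and $\left(a,b,\frac{a^2+k_1ab+b^2}{c}\right)$; (iii) if $c$ is the maximal number in $(a,b,c)$, the children are $\left(\frac{b^2+k_2bc+c^2}{a},b,c\right)$ and $\left(a,\frac{a^2+k_3ac+c^2}{b},c\right)$. -}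

module Defs where

open import Data.Nat using (ℕ; zero; suc; _+_; _*_; _≤_; _≤?_; _/_)
open import Data.Bool using (Bool; true; false)
open import Data.List using (List; []; _∷_)
open import Data.Fin using (Fin)
open import Data.Product using (_×_; _,_)
open import Relation.Nullary using (yes; no)
open import Relation.Binary.PropositionalEquality using (_≡_)

Triple : Set
Triple = ℕ × ℕ × ℕ

-- Natural-number division; the divisor is always positive in the tree
-- (and the quotient is exact there), the zero case is a dummy value.
divℕ : ℕ → ℕ → ℕ
divℕ n zero    = 0
divℕ n (suc m) = n / suc m

-- The three "Vieta moves" used in the tree.
moveA : ℕ → ℕ → ℕ → Triple → Triple
moveA k₁ k₂ k₃ (a , b , c) = (divℕ (b * b + k₂ * b * c + c * c) a , b , c)

moveB : ℕ → ℕ → ℕ → Triple → Triple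
moveB k₁ k₂ k₃ (a , b , c) = (a , divℕ (a * a + k₃ * a * c + c * c) b , c)

moveC : ℕ → ℕ → ℕ → Triple → Triple
moveC k₁ k₂ k₃ (a , b , c) = (a , b , divℕ (a * a + k₁ * a * b + b * b) c)

-- Child of a non-root vertex (a , b , c); the Bool selects the first
-- (false) or second (true) child listed in rule (3).
-- Case order (i), (ii), (iii) is used when the maximum is not unique.
sel : Bool → Triple → Triple → Triple
sel false x y = x
sel true  x y = y

child : ℕ → ℕ → ℕ → Triple → Bool → Triple
child k₁ k₂ k₃ (a , b , c) side with b ≤? a | c ≤? a | a ≤? b | c ≤? b
... | yes _ | yes _ | _     | _     =
  sel side (moveB k₁ k₂ k₃ (a , b , c)) (moveC k₁ k₂ k₃ (a , b , c))
... | _     | _     | yes _ | yes _ =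
  sel side (moveA k₁ k₂ k₃ (a , b , c)) (moveC k₁ k₂ k₃ (a , b , c))
... | _     | _     | _     | _     =
  sel side (moveA k₁ k₂ k₃ (a , b , c)) (moveB k₁ k₂ k₃ (a , b , c))

-- Vertices of the tree T^{k₁,k₂,k₃}: the root, or one of the three
-- children of the root followed by a finite path of left/right choices.
data Vertex : Set where
  root   : Vertex
  branch : Fin 3 → List Bool → Vertex

rootChild : ℕ → ℕ → ℕ → Fin 3 → Triple
rootChild k₁ k₂ k₃ Fin.zero             = (k₂ + 2 , 1 , 1)
rootChild k₁ k₂ k₃ (Fin.suc Fin.zero)   = (1 , k₃ + 2 , 1)
rootChild k₁ k₂ k₃ (Fin.suc (Fin.suc _)) = (1 , 1 , k₁ + 2)

followPath : ℕ → ℕ → ℕ → Triple → List Bool → Triple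
followPath k₁ k₂ k₃ t []       = t
followPath k₁ k₂ k₃ t (s ∷ ss) = followPath k₁ k₂ k₃ (child k₁ k₂ k₃ t s) ss

label : ℕ → ℕ → ℕ → Vertex → Triple
label k₁ k₂ k₃ root          = (1 , 1 , 1)
label k₁ k₂ k₃ (branch i ss) = followPath k₁ k₂ k₃ (rootChild k₁ k₂ k₃ i) ss

IsSolution : ℕ → ℕ → ℕ → ℕ → ℕ → ℕ → Set
IsSolution k₁ k₂ k₃ x y z =
  x * x + y * y + z * z + k₁ * x * y + k₂ * y * z + k₃ * z * x
    ≡ (3 + k₁ + k₂ + k₃) * x * y * z

-- With two coordinates fixed, (∗) is a monic quadratic in the third, so a
-- positive solution (x, y, z) has a Vieta partner (x′, y, z) with
-- x·x′ = y² + k₂yz + z²; the moves of the tree are exactly these flips.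
-- The quadratic is negative at m = max(y, z) when m ≥ 2 (and non-positive
-- when m = 1), so m lies between x and x′.  Hence flipping a non-maximal
-- coordinate of a solution with a strict maximum creates a new strict maximum
-- (every tree label is a solution whose parent is recovered by flipping its
-- maximum, which makes labels unique), while flipping a maximal coordinate
-- decreases a + b + c, so descent from any solution reaches (1, 1, 1).

module Submission where

open import Defs
open import Data.Nat
open import Data.Nat.Properties
open import Data.Nat.DivMod using (m*n/n≡m; n/1≡n)
open import Data.Nat.Induction using (<-wellFounded)
open import Data.Nat.Tactic.RingSolver using (solve-∀)
open import Data.Bool using (Bool; true; false)
open import Data.Fin as Fin using (Fin)
open import Data.List using (List; []; _∷_; _++_; reverse)
open import Data.List.Properties using (unfold-reverse; reverse-involutive; reverse-injective)
open import Data.Product using (Σ; ∃; ∃₂; _×_; _,_; proj₁; proj₂)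
open import Data.Sum using (_⊎_; inj₁; inj₂)
open import Function using (_$_; _∘_; _on_; _⇔_; mk⇔; Equivalence)
open import Induction.WellFounded using (Acc; acc)
open import Relation.Binary.Construct.On using (wellFounded)
open import Relation.Nullary using (¬_; yes; no; contradiction)
open import Relation.Binary.PropositionalEquality

divℕ-exact : ∀ {q x x′} → 0 < x → x * x′ ≡ q → divℕ q x ≡ x′
divℕ-exact {x = suc n} {x′} _ refl = trans (cong (_/ suc n) (*-comm (suc n) x′)) (m*n/n≡m x′ (suc n))

module _ {m x x′ : ℕ} where

  -- m·x + m·x′ against m·m + x·x′ compares (x − m)(x′ − m) with 0.
  private
    gap-above : ∀ {p q} → m + p ≡ x → m + q ≡ x′ → m * x + m * x′ + p * q ≡ m * m + x * x′
    gap-above {p} {q} refl refl = identity m p q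
      where
      identity : ∀ m p q → m * (m + p) + m * (m + q) + p * q ≡ m * m + (m + p) * (m + q)
      identity = solve-∀

    gap-below : ∀ {p q} → x + p ≡ m → x′ + q ≡ m → m * x + m * x′ + p * q ≡ m * m + x * x′
    gap-below {p} {q} e₁ e₂ = begin
      m * x + m * x′ + p * q               ≡⟨ cong₂ (λ u v → u * x + v * x′ + p * q) (sym e₂) (sym e₁) ⟩
      (x′ + q) * x + (x + p) * x′ + p * q  ≡⟨ identity x x′ p q ⟩
      (x + p) * (x′ + q) + x * x′          ≡⟨ cong₂ (λ u v → u * v + x * x′) e₁ e₂ ⟩
      m * m + x * x′                       ∎
      where
      open ≡-Reasoning
      identity : ∀ x x′ p q → (x′ + q) * x + (x + p) * x′ + p * q ≡ (x + p) * (x′ + q) + x * x′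
      identity = solve-∀

    roots-above : m ≤ x → m ≤ x′ → m * x + m * x′ ≤ m * m + x * x′
    roots-above m≤x m≤x′
      with p , e₁ ← m≤n⇒∃[o]m+o≡n m≤x | q , e₂ ← m≤n⇒∃[o]m+o≡n m≤x′
      = subst (m * x + m * x′ ≤_) (gap-above e₁ e₂) (m≤m+n _ (p * q))

    roots-strictly-above : m < x → m < x′ → m * x + m * x′ < m * m + x * x′
    roots-strictly-above m<x m<x′
      with p , e₁ ← m≤n⇒∃[o]m+o≡n m<x | q , e₂ ← m≤n⇒∃[o]m+o≡n m<x′
      = subst (m * x + m * x′ <_) (gap-above (trans (+-suc m p) e₁) (trans (+-suc m q) e₂))
          (m<m+n (m * x + m * x′) z<s)

    roots-below : x ≤ m → x′ ≤ m → m * x + m * x′ ≤ m * m + x * x′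
    roots-below x≤m x′≤m
      with p , e₁ ← m≤n⇒∃[o]m+o≡n x≤m | q , e₂ ← m≤n⇒∃[o]m+o≡n x′≤m
      = subst (m * x + m * x′ ≤_) (gap-below e₁ e₂) (m≤m+n _ (p * q))

  strictly-between : m * m + x * x′ < m * x + m * x′ → (x < m → m < x′) × (m ≤ x → x′ < m)
  strictly-between h =
    (λ x<m → ≰⇒> λ x′≤m → <⇒≱ h (roots-below (<⇒≤ x<m) x′≤m)) ,
    (λ m≤x → ≰⇒> λ m≤x′ → <⇒≱ h (roots-above m≤x m≤x′))

  not-both-above : m * m + x * x′ ≤ m * x + m * x′ → m < x → x′ ≤ m
  not-both-above h m<x = ≮⇒≥ λ m<x′ → ≤⇒≯ h (roots-strictly-above m<x m<x′)

module MonicQuadratic (Q L R : ℕ) where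

  IsRoot : ℕ → Set
  IsRoot x = x * x + Q + x * L ≡ x * R

  record VietaPair (x x′ : ℕ) : Set where
    field
      product : x * x′ ≡ Q
      sum     : L + x + x′ ≡ R

  vietaPair : ∀ {x} → 0 < x → IsRoot x → VietaPair x (divℕ Q x)
  vietaPair {x} 0<x x-root = subst (VietaPair x) (sym (divℕ-exact 0<x product)) pair
    where
    open ≡-Reasoning
    x·R≡x·[L+x]+Q : x * R ≡ x * (L + x) + Q
    x·R≡x·[L+x]+Q = trans (sym x-root) (identity x Q L)
      where
      identity : ∀ x Q L → x * x + Q + x * L ≡ x * (L + x) + Q
      identity = solve-∀
    L+x≤R : L + x ≤ R
    L+x≤R = *-cancelˡ-≤ x {{>-nonZero 0<x}}
      (subst (x * (L + x) ≤_) (sym x·R≡x·[L+x]+Q) (m≤m+n _ Q))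
    product : x * (R ∸ (L + x)) ≡ Q
    product = begin
      x * (R ∸ (L + x))             ≡⟨ *-distribˡ-∸ x R (L + x) ⟩
      x * R ∸ x * (L + x)           ≡⟨ cong (_∸ x * (L + x)) x·R≡x·[L+x]+Q ⟩
      x * (L + x) + Q ∸ x * (L + x) ≡⟨ m+n∸m≡n (x * (L + x)) Q ⟩
      Q                             ∎
    pair : VietaPair x (R ∸ (L + x))
    pair = record { product = product ; sum = m+[n∸m]≡n L+x≤R }

  module _ {x x′ : ℕ} (pair : VietaPair x x′) where
    open VietaPair pair

    partner-isRoot : IsRoot x′
    partner-isRoot = begin
      x′ * x′ + Q + x′ * L      ≡⟨ cong (λ q → x′ * x′ + q + x′ * L) (sym product) ⟩
      x′ * x′ + x * x′ + x′ * L ≡⟨ identity x x′ L ⟩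
      x′ * (L + x + x′)         ≡⟨ cong (x′ *_) sum ⟩
      x′ * R                    ∎
      where
      open ≡-Reasoning
      identity : ∀ x x′ L → x′ * x′ + x * x′ + x′ * L ≡ x′ * (L + x + x′)
      identity = solve-∀

    partner-pos : 0 < Q → 0 < x′
    partner-pos 0<Q = n≢0⇒n>0 λ { refl → <⇒≢ 0<Q (trans (sym (*-zeroʳ x)) product) }

    partner-partner : 0 < Q → divℕ Q x′ ≡ x
    partner-partner 0<Q = divℕ-exact (partner-pos 0<Q) (trans (*-comm x′ x) product)

    private
      rearrange : ∀ m → (m * m + Q + m * L ≡ m * m + x * x′ + m * L) × (m * R ≡ m * x + m * x′ + m * L)
      rearrange m =
        cong (λ q → m * m + q + m * L) (sym product) ,
        trans (cong (m *_) (sym sum)) (identity m x x′ L)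
        where
        identity : ∀ m x x′ L → m * (L + x + x′) ≡ m * x + m * x′ + m * L
        identity = solve-∀

    separated-by : ∀ {m} → m * m + Q + m * L < m * R → (x < m → m < x′) × (m ≤ x → x′ < m)
    separated-by {m} h with l , r ← rearrange m =
      strictly-between (+-cancelʳ-< (m * L) _ _ (subst₂ _<_ l r h))

    weakly-separated-by : ∀ {m} → m * m + Q + m * L ≤ m * R → m < x → x′ ≤ m
    weakly-separated-by {m} h with l , r ← rearrange m =
      not-both-above (+-cancelʳ-≤ (m * L) _ _ (subst₂ _≤_ l r h))

form : ℕ → ℕ → ℕ → ℕ
form β y z = y * y + β * y * z + z * z

form-pos : ∀ β {y z} → 0 < y → 0 < form β y z
form-pos β {suc _} _ = z<s

-- (∗) as a quadratic equation in x; α, β and γ are the coefficients of xy, yz and zx.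
module Equation (α β γ y z : ℕ) where
  open MonicQuadratic (form β y z) (α * y + γ * z) ((3 + α + β + γ) * y * z) public

module _ (α β γ : ℕ) {y z : ℕ} (0<z : 0 < z) (z≤y : z ≤ y) where
  private
    instance
      z≢0 : NonZero z
      z≢0 = >-nonZero 0<z
      y≢0 : NonZero y
      y≢0 = >-nonZero (≤-trans 0<z z≤y)
      yz≢0 : NonZero (y * z)
      yz≢0 = m*n≢0 y z

    split-value : y * y + form β y z + y * (α * y + γ * z)
                ≡ (y * y + y * y + z * z) + (α * (y * y) + β * (y * z) + γ * (y * z))
    split-value = identity α β γ y z
      where
      identity : ∀ α β γ y z → y * y + (y * y + β * y * z + z * z) + y * (α * y + γ * z)
                             ≡ (y * y + y * y + z * z) + (α * (y * y) + β * (y * z) + γ * (y * z))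
      identity = solve-∀

    split-target : y * ((3 + α + β + γ) * y * z)
                 ≡ (y * y * z + y * y * z + y * z * y) + (α * (y * y * z) + β * (y * z * y) + γ * (y * z * y))
    split-target = identity α β γ y z
      where
      identity : ∀ α β γ y z → y * ((3 + α + β + γ) * y * z)
                 ≡ (y * y * z + y * y * z + y * z * y) + (α * (y * y * z) + β * (y * z * y) + γ * (y * z * y))
      identity = solve-∀

    yy≤yyz : y * y ≤ y * y * z
    yy≤yyz = m≤m*n (y * y) z

    zz≤yz : z * z ≤ y * z
    zz≤yz = *-monoˡ-≤ z z≤y

    cross-terms : α * (y * y) + β * (y * z) + γ * (y * z) ≤ α * (y * y * z) + β * (y * z * y) + γ * (y * z * y)
    cross-terms = +-mono-≤ (+-mono-≤ (*-monoʳ-≤ α yy≤yyz) (*-monoʳ-≤ β (m≤m*n (y * z) y)))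
                     (*-monoʳ-≤ γ (m≤m*n (y * z) y))

  nonpositive-at-larger : y * y + form β y z + y * (α * y + γ * z) ≤ y * ((3 + α + β + γ) * y * z)
  nonpositive-at-larger = subst₂ _≤_ (sym split-value) (sym split-target)
    (+-mono-≤ (+-mono-≤ (+-mono-≤ yy≤yyz yy≤yyz) (≤-trans zz≤yz (m≤m*n (y * z) y))) cross-terms)

  negative-at-larger : 2 ≤ y → y * y + form β y z + y * (α * y + γ * z) < y * ((3 + α + β + γ) * y * z)
  negative-at-larger 2≤y = subst₂ _<_ (sym split-value) (sym split-target)
    (+-mono-<-≤ (+-mono-≤-< (+-mono-≤ yy≤yyz yy≤yyz) (≤-<-trans zz≤yz (m<m*n (y * z) y 2≤y)))
                cross-terms)

module _ (α β γ : ℕ) {y z : ℕ} (0<y : 0 < y) (0<z : 0 < z) where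
  private
    swap-yz : ∀ (_∼_ : ℕ → ℕ → Set) m →
      (m * m + form β z y + m * (γ * z + α * y)) ∼ (m * ((3 + γ + β + α) * z * y)) →
      (m * m + form β y z + m * (α * y + γ * z)) ∼ (m * ((3 + α + β + γ) * y * z))
    swap-yz _∼_ m = subst₂ _∼_ (value α β γ y z m) (target α β γ y z m)
      where
      value : ∀ α β γ y z m → m * m + (z * z + β * z * y + y * y) + m * (γ * z + α * y)
                            ≡ m * m + (y * y + β * y * z + z * z) + m * (α * y + γ * z)
      value = solve-∀
      target : ∀ α β γ y z m → m * ((3 + γ + β + α) * z * y) ≡ m * ((3 + α + β + γ) * y * z)
      target = solve-∀

  nonpositive-at-max : (y ⊔ z) * (y ⊔ z) + form β y z + (y ⊔ z) * (α * y + γ * z)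
            ≤ (y ⊔ z) * ((3 + α + β + γ) * y * z)
  nonpositive-at-max with ≤-total z y
  ... | inj₁ z≤y rewrite m≥n⇒m⊔n≡m z≤y = nonpositive-at-larger α β γ 0<z z≤y
  ... | inj₂ y≤z rewrite m≤n⇒m⊔n≡n y≤z = swap-yz _≤_ z (nonpositive-at-larger γ β α 0<y y≤z)

  negative-at-max : 2 ≤ y ⊔ z → (y ⊔ z) * (y ⊔ z) + form β y z + (y ⊔ z) * (α * y + γ * z)
                        < (y ⊔ z) * ((3 + α + β + γ) * y * z)
  negative-at-max 2≤m with ≤-total z y
  ... | inj₁ z≤y rewrite m≥n⇒m⊔n≡m z≤y = negative-at-larger α β γ 0<z z≤y 2≤m
  ... | inj₂ y≤z rewrite m≤n⇒m⊔n≡n y≤z = swap-yz _<_ z (negative-at-larger γ β α 0<y y≤z 2≤m)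

module VietaFlip (α β γ y z : ℕ) {x : ℕ} (0<x : 0 < x) (0<y : 0 < y) (0<z : 0 < z)
                 (x-root : Equation.IsRoot α β γ y z x) where
  open Equation α β γ y z

  private
    pair : VietaPair x (divℕ (form β y z) x)
    pair = vietaPair 0<x x-root

  flipped-root : IsRoot (divℕ (form β y z) x)
  flipped-root = partner-isRoot pair

  flipped-pos : 0 < divℕ (form β y z) x
  flipped-pos = partner-pos pair (form-pos β 0<y)

  flip-involutive : divℕ (form β y z) (divℕ (form β y z) x) ≡ x
  flip-involutive = partner-partner pair (form-pos β 0<y)

  flip-ascends : x < y ⊔ z → y ⊔ z < divℕ (form β y z) x
  flip-ascends x<m = proj₁ (separated-by pair (negative-at-max α β γ 0<y 0<z (≤-trans (s≤s 0<x) x<m))) x<m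

  flip-descends : y ⊔ z ≤ x → 2 ≤ x → divℕ (form β y z) x ≤ y ⊔ z × divℕ (form β y z) x < x
  flip-descends m≤x 2≤x with m≤n⇒m<n∨m≡n m≤x
  ... | inj₁ m<x = x′≤m , ≤-<-trans x′≤m m<x
    where x′≤m = weakly-separated-by pair (nonpositive-at-max α β γ 0<y 0<z) m<x
  ... | inj₂ m≡x = <⇒≤ x′<m , subst (divℕ (form β y z) x <_) m≡x x′<m
    where
    x′<m = proj₂ (separated-by pair (negative-at-max α β γ 0<y 0<z (subst (2 ≤_) (sym m≡x) 2≤x))) m≤x

Coord : Set
Coord = Fin 3

pattern A = Fin.zero
pattern B = Fin.suc Fin.zero
pattern C = Fin.suc (Fin.suc Fin.zero)

at : Coord → Triple → ℕ
at A (a , _ , _) = a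
at B (_ , b , _) = b
at C (_ , _ , c) = c

rest : Coord → Triple → ℕ
rest A (_ , b , c) = b ⊔ c
rest B (a , _ , c) = a ⊔ c
rest C (a , b , _) = a ⊔ b

record StrictMaxAt (p : Coord) (t : Triple) : Set where
  constructor strictMax
  field rest<at : rest p t < at p t

size : Triple → ℕ
size (a , b , c) = a + b + c

at-≤-rest : ∀ {p q} t → q ≢ p → at q t ≤ rest p t
at-≤-rest {A} {A} _           q≢p = contradiction refl q≢p
at-≤-rest {A} {B} (_ , b , c) _   = m≤m⊔n b c
at-≤-rest {A} {C} (_ , b , c) _   = m≤n⊔m b c
at-≤-rest {B} {A} (a , _ , c) _   = m≤m⊔n a c
at-≤-rest {B} {B} _           q≢p = contradiction refl q≢p
at-≤-rest {B} {C} (a , _ , c) _   = m≤n⊔m a c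
at-≤-rest {C} {A} (a , b , _) _   = m≤m⊔n a b
at-≤-rest {C} {B} (a , b , _) _   = m≤n⊔m a b
at-≤-rest {C} {C} _           q≢p = contradiction refl q≢p

strictMax-unique : ∀ {p q t} → StrictMaxAt p t → StrictMaxAt q t → p ≡ q
strictMax-unique {p} {q} {t} (strictMax p-max) (strictMax q-max) with p Fin.≟ q
... | yes p≡q = p≡q
... | no p≢q = contradiction q-max
  (<⇒≯ (<-≤-trans (≤-<-trans (at-≤-rest t (≢-sym p≢q)) p-max) (at-≤-rest t p≢q)))

max-coord : ∀ t → ∃ λ p → rest p t ≤ at p t
max-coord (a , b , c) with ≤-total b a | ≤-total c a | ≤-total c b
... | inj₁ b≤a | inj₁ c≤a | _        = A , ⊔-lub b≤a c≤a
... | inj₁ b≤a | inj₂ a≤c | _        = C , ⊔-lub a≤c (≤-trans b≤a a≤c)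
... | inj₂ a≤b | _        | inj₁ c≤b = B , ⊔-lub a≤b c≤b
... | inj₂ a≤b | _        | inj₂ b≤c = C , ⊔-lub (≤-trans a≤b b≤c) b≤c

-- Rule (3): the child on side s of a vertex with strict maximum at p replaces coordinate other p s.
other : Coord → Bool → Coord
other A false = B
other A true  = C
other B false = A
other B true  = C
other C false = A
other C true  = B

other-≢ : ∀ p s → other p s ≢ p
other-≢ A false ()
other-≢ A true  ()
other-≢ B false ()
other-≢ B true  ()
other-≢ C false ()
other-≢ C true  ()

other-injective : ∀ p {s s′} → other p s ≡ other p s′ → s ≡ s′
other-injective p {false} {false} _ = refl
other-injective p {true}  {true}  _ = refl
other-injective A {false} {true}  ()
other-injective A {true}  {false} ()
other-injective B {false} {true}  ()
other-injective B {true}  {false} ()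
other-injective C {false} {true}  ()
other-injective C {true}  {false} ()

other-onto : ∀ p q → q ≢ p → ∃ λ s → other p s ≡ q
other-onto A A q≢p = contradiction refl q≢p
other-onto A B _   = false , refl
other-onto A C _   = true , refl
other-onto B A _   = false , refl
other-onto B B q≢p = contradiction refl q≢p
other-onto B C _   = true , refl
other-onto C A _   = false , refl
other-onto C B _   = true , refl
other-onto C C q≢p = contradiction refl q≢p

followPath-snoc : ∀ k₁ k₂ k₃ t xs s →
  followPath k₁ k₂ k₃ t (xs ++ s ∷ []) ≡ child k₁ k₂ k₃ (followPath k₁ k₂ k₃ t xs) s
followPath-snoc k₁ k₂ k₃ t []       s = refl
followPath-snoc k₁ k₂ k₃ t (x ∷ xs) s = followPath-snoc k₁ k₂ k₃ (child k₁ k₂ k₃ t x) xs s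

form-one-one : ∀ k → 1 * 1 + k * 1 * 1 + 1 * 1 ≡ k + 2
form-one-one = solve-∀

root-solution : ∀ k₁ k₂ k₃ → 1 * 1 + 1 * 1 + 1 * 1 + k₁ * 1 * 1 + k₂ * 1 * 1 + k₃ * 1 * 1
                            ≡ (3 + k₁ + k₂ + k₃) * 1 * 1 * 1
root-solution = solve-∀

bounded-by-one : ∀ {a b c} → 0 < a → 0 < b → 0 < c → a ≤ 1 → b ≤ 1 → c ≤ 1 →
                 (a , b , c) ≡ (1 , 1 , 1)
bounded-by-one z<s z<s z<s (s≤s z≤n) (s≤s z≤n) (s≤s z≤n) = refl

module Tree (k₁ k₂ k₃ : ℕ) where

  move : Coord → Triple → Triple
  move A = moveA k₁ k₂ k₃
  move B = moveB k₁ k₂ k₃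
  move C = moveC k₁ k₂ k₃

  PositiveSolution : Triple → Set
  PositiveSolution (a , b , c) = 0 < a × 0 < b × 0 < c × IsSolution k₁ k₂ k₃ a b c

  rest-move : ∀ p t → rest p (move p t) ≡ rest p t
  rest-move A _ = refl
  rest-move B _ = refl
  rest-move C _ = refl

  move-shrinks : ∀ p t → at p (move p t) < at p t → size (move p t) < size t
  move-shrinks A (a , b , c) lt = +-monoˡ-< c (+-monoˡ-< b lt)
  move-shrinks B (a , b , c) lt = +-monoˡ-< c (+-monoʳ-< a lt)
  move-shrinks C (a , b , c) lt = +-monoʳ-< (a + b) lt

  move-root : ∀ p → move p (1 , 1 , 1) ≡ rootChild k₁ k₂ k₃ p
  move-root A = cong (_, 1 , 1) (trans (n/1≡n _) (form-one-one k₂))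
  move-root B = cong (λ u → 1 , u , 1) (trans (n/1≡n _) (form-one-one k₃))
  move-root C = cong (λ u → 1 , 1 , u) (trans (n/1≡n _) (form-one-one k₁))

  private
    ≡⇔≡ : ∀ {l r l′ r′ : ℕ} → l ≡ l′ → r ≡ r′ → (l ≡ r) ⇔ (l′ ≡ r′)
    ≡⇔≡ refl refl = mk⇔ (λ e → e) (λ e → e)

  solution⇔rootᴬ : ∀ {a b c} → IsSolution k₁ k₂ k₃ a b c ⇔ Equation.IsRoot k₁ k₂ k₃ b c a
  solution⇔rootᴬ {a} {b} {c} = ≡⇔≡ (lhs k₁ k₂ k₃ a b c) (rhs k₁ k₂ k₃ a b c)
    where
    lhs : ∀ k₁ k₂ k₃ a b c → a * a + b * b + c * c + k₁ * a * b + k₂ * b * c + k₃ * c * a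
                           ≡ a * a + (b * b + k₂ * b * c + c * c) + a * (k₁ * b + k₃ * c)
    lhs = solve-∀
    rhs : ∀ k₁ k₂ k₃ a b c → (3 + k₁ + k₂ + k₃) * a * b * c ≡ a * ((3 + k₁ + k₂ + k₃) * b * c)
    rhs = solve-∀

  solution⇔rootᴮ : ∀ {a b c} → IsSolution k₁ k₂ k₃ a b c ⇔ Equation.IsRoot k₁ k₃ k₂ a c b
  solution⇔rootᴮ {a} {b} {c} = ≡⇔≡ (lhs k₁ k₂ k₃ a b c) (rhs k₁ k₂ k₃ a b c)
    where
    lhs : ∀ k₁ k₂ k₃ a b c → a * a + b * b + c * c + k₁ * a * b + k₂ * b * c + k₃ * c * a
                           ≡ b * b + (a * a + k₃ * a * c + c * c) + b * (k₁ * a + k₂ * c)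
    lhs = solve-∀
    rhs : ∀ k₁ k₂ k₃ a b c → (3 + k₁ + k₂ + k₃) * a * b * c ≡ b * ((3 + k₁ + k₃ + k₂) * a * c)
    rhs = solve-∀

  solution⇔rootᶜ : ∀ {a b c} → IsSolution k₁ k₂ k₃ a b c ⇔ Equation.IsRoot k₃ k₁ k₂ a b c
  solution⇔rootᶜ {a} {b} {c} = ≡⇔≡ (lhs k₁ k₂ k₃ a b c) (rhs k₁ k₂ k₃ a b c)
    where
    lhs : ∀ k₁ k₂ k₃ a b c → a * a + b * b + c * c + k₁ * a * b + k₂ * b * c + k₃ * c * a
                           ≡ c * c + (a * a + k₁ * a * b + b * b) + c * (k₃ * a + k₂ * b)
    lhs = solve-∀
    rhs : ∀ k₁ k₂ k₃ a b c → (3 + k₁ + k₂ + k₃) * a * b * c ≡ c * ((3 + k₃ + k₁ + k₂) * a * b)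
    rhs = solve-∀

  record VietaMove (p : Coord) (t : Triple) : Set where
    field
      solution   : PositiveSolution (move p t)
      involutive : move p (move p t) ≡ t
      ascends    : at p t < rest p t → rest p t < at p (move p t)
      descends   : rest p t ≤ at p t → 2 ≤ at p t →
                   at p (move p t) ≤ rest p t × at p (move p t) < at p t

  vietaMove : ∀ p t → PositiveSolution t → VietaMove p t
  vietaMove A (a , b , c) (0<a , 0<b , 0<c , sol) = record
    { solution   = flipped-pos , 0<b , 0<c , Equivalence.from solution⇔rootᴬ flipped-root
    ; involutive = cong (_, b , c) flip-involutive
    ; ascends    = flip-ascends
    ; descends   = flip-descends
    }
    where open VietaFlip k₁ k₂ k₃ b c 0<a 0<b 0<c (Equivalence.to solution⇔rootᴬ sol)
  vietaMove B (a , b , c) (0<a , 0<b , 0<c , sol) = record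
    { solution   = 0<a , flipped-pos , 0<c , Equivalence.from solution⇔rootᴮ flipped-root
    ; involutive = cong (λ u → a , u , c) flip-involutive
    ; ascends    = flip-ascends
    ; descends   = flip-descends
    }
    where open VietaFlip k₁ k₃ k₂ a c 0<b 0<a 0<c (Equivalence.to solution⇔rootᴮ sol)
  vietaMove C (a , b , c) (0<a , 0<b , 0<c , sol) = record
    { solution   = 0<a , 0<b , flipped-pos , Equivalence.from solution⇔rootᶜ flipped-root
    ; involutive = cong (λ u → a , b , u) flip-involutive
    ; ascends    = flip-ascends
    ; descends   = flip-descends
    }
    where open VietaFlip k₃ k₁ k₂ a b 0<c 0<a 0<b (Equivalence.to solution⇔rootᶜ sol)

  private
    sel-other : ∀ p s {t} → sel s (move (other p false) t) (move (other p true) t) ≡ move (other p s) t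
    sel-other p false = refl
    sel-other p true  = refl

  child-move : ∀ {p} t s → StrictMaxAt p t → child k₁ k₂ k₃ t s ≡ move (other p s) t
  child-move {A} (a , b , c) s (strictMax bc<a) with b ≤? a | c ≤? a | a ≤? b | c ≤? b
  ... | yes _  | yes _  | _ | _ = sel-other A s
  ... | no b≰a | _      | _ | _ = contradiction (<⇒≤ (m⊔n<o⇒m<o b c bc<a)) b≰a
  ... | yes _  | no c≰a | _ | _ = contradiction (<⇒≤ (m⊔n<o⇒n<o b c bc<a)) c≰a
  child-move {B} (a , b , c) s (strictMax ac<b) with b ≤? a | c ≤? a | a ≤? b | c ≤? b
  ... | yes b≤a | _ | _      | _      = contradiction b≤a (<⇒≱ (m⊔n<o⇒m<o a c ac<b))
  ... | no _    | _ | yes _  | yes _  = sel-other B s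
  ... | no _    | _ | no a≰b | _      = contradiction (<⇒≤ (m⊔n<o⇒m<o a c ac<b)) a≰b
  ... | no _    | _ | yes _  | no c≰b = contradiction (<⇒≤ (m⊔n<o⇒n<o a c ac<b)) c≰b
  child-move {C} (a , b , c) s (strictMax ab<c) with b ≤? a | c ≤? a | a ≤? b | c ≤? b
  ... | _     | yes c≤a | _     | _       = contradiction c≤a (<⇒≱ (m⊔n<o⇒m<o a b ab<c))
  ... | _     | no _    | _     | yes c≤b = contradiction c≤b (<⇒≱ (m⊔n<o⇒n<o a b ab<c))
  ... | yes _ | no _    | yes _ | no _    = sel-other C s
  ... | yes _ | no _    | no _  | no _    = sel-other C s
  ... | no _  | no _    | yes _ | no _    = sel-other C s
  ... | no _  | no _    | no _  | no _    = sel-other C s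

  record ChildOf (t u : Triple) : Set where
    field
      solution  : PositiveSolution t
      axis      : Coord
      strict    : StrictMaxAt axis t
      to-parent : move axis t ≡ u
  open ChildOf

  flip-strict : ∀ {p q t} → PositiveSolution t → StrictMaxAt p t → q ≢ p → StrictMaxAt q (move q t)
  flip-strict {p} {q} {t} sol (strictMax p-max) q≢p = strictMax $
    subst (_< at q (move q t)) (sym (rest-move q t)) (VietaMove.ascends (vietaMove q t sol) q-low)
    where
    q-low : at q t < rest q t
    q-low = <-≤-trans (≤-<-trans (at-≤-rest t q≢p) p-max) (at-≤-rest t (≢-sym q≢p))

  child-strict : ∀ {t u} (c : ChildOf t u) s → StrictMaxAt (other (axis c) s) (child k₁ k₂ k₃ t s)
  child-strict {t} c s = subst (StrictMaxAt (other (axis c) s)) (sym (child-move t s (strict c)))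
    (flip-strict (solution c) (strict c) (other-≢ (axis c) s))

  child-childOf : ∀ {t u} → ChildOf t u → ∀ s → ChildOf (child k₁ k₂ k₃ t s) t
  child-childOf {t} c s = record
    { solution  = subst PositiveSolution (sym child≡move) (VietaMove.solution flip)
    ; axis      = other (axis c) s
    ; strict    = child-strict c s
    ; to-parent = trans (cong (move (other (axis c) s)) child≡move) (VietaMove.involutive flip)
    }
    where
    child≡move = child-move t s (strict c)
    flip = vietaMove (other (axis c) s) t (solution c)

  rootChild-childOf : ∀ i → ChildOf (rootChild k₁ k₂ k₃ i) (1 , 1 , 1)
  rootChild-childOf i = record
    { solution  = subst PositiveSolution (move-root i) (VietaMove.solution flip)
    ; axis      = i
    ; strict    = rootChild-strict i
    ; to-parent = trans (cong (move i) (sym (move-root i))) (VietaMove.involutive flip)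
    }
    where
    flip = vietaMove i (1 , 1 , 1) (z<s , z<s , z<s , root-solution k₁ k₂ k₃)
    rootChild-strict : ∀ i → StrictMaxAt i (rootChild k₁ k₂ k₃ i)
    rootChild-strict A = strictMax (m≤n+m 2 k₂)
    rootChild-strict B = strictMax (m≤n+m 2 k₃)
    rootChild-strict C = strictMax (m≤n+m 2 k₁)

  root-not-childOf : ∀ {u} → ¬ ChildOf (1 , 1 , 1) u
  root-not-childOf c with axis c | strict c
  ... | A | strictMax (s≤s ())
  ... | B | strictMax (s≤s ())
  ... | C | strictMax (s≤s ())

  parent-unique : ∀ {t u u′} → ChildOf t u → ChildOf t u′ → u ≡ u′
  parent-unique {t} c c′ = begin
    _                 ≡⟨ sym (to-parent c) ⟩
    move (axis c) t   ≡⟨ cong (λ p → move p t) (strictMax-unique (strict c) (strict c′)) ⟩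
    move (axis c′) t  ≡⟨ to-parent c′ ⟩
    _                 ∎
    where open ≡-Reasoning

  -- Branch labels, with the path given from its last step back to the root.
  labelʳ : Fin 3 → List Bool → Triple
  labelʳ i []       = rootChild k₁ k₂ k₃ i
  labelʳ i (s ∷ rs) = child k₁ k₂ k₃ (labelʳ i rs) s

  parentʳ : Fin 3 → List Bool → Triple
  parentʳ i []       = (1 , 1 , 1)
  parentʳ i (_ ∷ rs) = labelʳ i rs

  labelʳ-childOf : ∀ i rs → ChildOf (labelʳ i rs) (parentʳ i rs)
  labelʳ-childOf i []       = rootChild-childOf i
  labelʳ-childOf i (s ∷ rs) = child-childOf (labelʳ-childOf i rs) s

  root-≢-labelʳ : ∀ i rs → (1 , 1 , 1) ≢ labelʳ i rs
  root-≢-labelʳ i rs e = root-not-childOf (subst (λ t → ChildOf t (parentʳ i rs)) (sym e) (labelʳ-childOf i rs))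

  parentʳ-cong : ∀ i j rs rs′ → labelʳ i rs ≡ labelʳ j rs′ → parentʳ i rs ≡ parentʳ j rs′
  parentʳ-cong i j rs rs′ e = parent-unique (labelʳ-childOf i rs)
    (subst (λ t → ChildOf t (parentʳ j rs′)) (sym e) (labelʳ-childOf j rs′))

  labelʳ-injective : ∀ i j rs rs′ → labelʳ i rs ≡ labelʳ j rs′ → i ≡ j × rs ≡ rs′
  labelʳ-injective i j [] [] e =
    strictMax-unique (strict (rootChild-childOf i)) (subst (StrictMaxAt j) (sym e) (strict (rootChild-childOf j))) ,
    refl
  labelʳ-injective i j [] (s′ ∷ rs′) e =
    contradiction (parentʳ-cong i j [] (s′ ∷ rs′) e) (root-≢-labelʳ j rs′)
  labelʳ-injective i j (s ∷ rs) [] e =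
    contradiction (sym (parentʳ-cong i j (s ∷ rs) [] e)) (root-≢-labelʳ i rs)
  labelʳ-injective i j (s ∷ rs) (s′ ∷ rs′) e
    with refl , refl ← labelʳ-injective i j rs rs′ (parentʳ-cong i j (s ∷ rs) (s′ ∷ rs′) e)
    = refl , cong (_∷ rs) (other-injective (axis c)
        (strictMax-unique (child-strict c s)
          (subst (StrictMaxAt (other (axis c) s′)) (sym e) (child-strict c s′))))
    where c = labelʳ-childOf i rs

  Reachable : Triple → Set
  Reachable t = t ≡ (1 , 1 , 1) ⊎ ∃₂ λ i rs → labelʳ i rs ≡ t

  move-is-child : ∀ {p t u} → ChildOf t u → ¬ StrictMaxAt p t → ∃ λ s → child k₁ k₂ k₃ t s ≡ move p t
  move-is-child {p} {t} c ¬max with s , other≡p ← other-onto (axis c) p (λ { refl → ¬max (strict c) })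
    = s , trans (child-move t s (strict c)) (cong (λ q → move q t) other≡p)

  reachable-move : ∀ {p t} → Reachable t → ¬ StrictMaxAt p t → Reachable (move p t)
  reachable-move {p} (inj₁ refl) _ = inj₂ (p , [] , sym (move-root p))
  reachable-move (inj₂ (i , rs , refl)) ¬max with s , child≡ ← move-is-child (labelʳ-childOf i rs) ¬max
    = inj₂ (i , s ∷ rs , child≡)

  all-one : ∀ {p t} → PositiveSolution t → rest p t ≤ at p t → at p t ≤ 1 → t ≡ (1 , 1 , 1)
  all-one {A} {a , b , c} (0<a , 0<b , 0<c , _) r≤a a≤1 = bounded-by-one 0<a 0<b 0<c a≤1
    (≤-trans (m≤m⊔n b c) (≤-trans r≤a a≤1)) (≤-trans (m≤n⊔m b c) (≤-trans r≤a a≤1))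
  all-one {B} {a , b , c} (0<a , 0<b , 0<c , _) r≤b b≤1 = bounded-by-one 0<a 0<b 0<c
    (≤-trans (m≤m⊔n a c) (≤-trans r≤b b≤1)) b≤1 (≤-trans (m≤n⊔m a c) (≤-trans r≤b b≤1))
  all-one {C} {a , b , c} (0<a , 0<b , 0<c , _) r≤c c≤1 = bounded-by-one 0<a 0<b 0<c
    (≤-trans (m≤m⊔n a b) (≤-trans r≤c c≤1)) (≤-trans (m≤n⊔m a b) (≤-trans r≤c c≤1)) c≤1

  descend : ∀ {p t} → PositiveSolution t → rest p t ≤ at p t → 2 ≤ at p t →
            size (move p t) < size t × ¬ StrictMaxAt p (move p t)
  descend {p} {t} sol rest≤at 2≤at
    with at′≤rest , at′<at ← VietaMove.descends (vietaMove p t sol) rest≤at 2≤at =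
    move-shrinks p t at′<at ,
    λ { (strictMax r<a) → <⇒≱ r<a (subst (at p (move p t) ≤_) (sym (rest-move p t)) at′≤rest) }

  reachable : ∀ t → Acc (_<_ on size) t → PositiveSolution t → Reachable t
  reachable t (acc smaller) sol with p , rest≤at ← max-coord t | at p t ≤? 1
  ... | yes at≤1 = inj₁ (all-one {p} sol rest≤at at≤1)
  ... | no at≰1 with shrinks , ¬max ← descend {p} sol rest≤at (≰⇒> at≰1) =
    subst Reachable (VietaMove.involutive flip)
      (reachable-move (reachable (move p t) (smaller shrinks) (VietaMove.solution flip)) ¬max)
    where flip = vietaMove p t sol

  label-branch : ∀ i rs → label k₁ k₂ k₃ (branch i (reverse rs)) ≡ labelʳ i rs
  label-branch i []       = refl
  label-branch i (s ∷ rs) = begin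
    followPath k₁ k₂ k₃ (rootChild k₁ k₂ k₃ i) (reverse (s ∷ rs))
      ≡⟨ cong (followPath k₁ k₂ k₃ (rootChild k₁ k₂ k₃ i)) (unfold-reverse s rs) ⟩
    followPath k₁ k₂ k₃ (rootChild k₁ k₂ k₃ i) (reverse rs ++ s ∷ [])
      ≡⟨ followPath-snoc k₁ k₂ k₃ _ (reverse rs) s ⟩
    child k₁ k₂ k₃ (label k₁ k₂ k₃ (branch i (reverse rs))) s
      ≡⟨ cong (λ t → child k₁ k₂ k₃ t s) (label-branch i rs) ⟩
    labelʳ i (s ∷ rs) ∎
    where open ≡-Reasoning

  label-branch′ : ∀ i ts → label k₁ k₂ k₃ (branch i ts) ≡ labelʳ i (reverse ts)
  label-branch′ i ts =
    trans (cong (label k₁ k₂ k₃ ∘ branch i) (sym (reverse-involutive ts))) (label-branch i (reverse ts))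

  label-surjective : ∀ {t} → PositiveSolution t → ∃ λ v → label k₁ k₂ k₃ v ≡ t
  label-surjective {t} sol with reachable t (wellFounded size <-wellFounded t) sol
  ... | inj₁ refl             = root , refl
  ... | inj₂ (i , rs , lab≡t) = branch i (reverse rs) , trans (label-branch i rs) lab≡t

  label-injective : ∀ v w → label k₁ k₂ k₃ v ≡ label k₁ k₂ k₃ w → v ≡ w
  label-injective root root _ = refl
  label-injective root (branch j ts) e =
    contradiction (trans e (label-branch′ j ts)) (root-≢-labelʳ j (reverse ts))
  label-injective (branch i ts) root e =
    contradiction (trans (sym e) (label-branch′ i ts)) (root-≢-labelʳ i (reverse ts))
  label-injective (branch i ts) (branch j ts′) e
    with refl , rev≡ ← labelʳ-injective i j (reverse ts) (reverse ts′)
                         (trans (sym (label-branch′ i ts)) (trans e (label-branch′ j ts′)))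
    = cong (branch i) (reverse-injective rev≡)

theorem1p1 : (k₁ k₂ k₃ : ℕ) (x y z : ℕ) → x > 0 → y > 0 → z > 0 →
    IsSolution k₁ k₂ k₃ x y z →
    Σ Vertex (λ v → (label k₁ k₂ k₃ v ≡ (x , y , z)) ×
    ((w : Vertex) → label k₁ k₂ k₃ w ≡ (x , y , z) → w ≡ v))
theorem1p1 k₁ k₂ k₃ x y z 0<x 0<y 0<z sol =
  let v , label≡ = label-surjective (0<x , 0<y , 0<z , sol)
  in v , label≡ , λ w label≡′ → label-injective w v (trans label≡′ (sym label≡))
  where open Tree k₁ k₂ k₃
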